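{- Let $a,b,n,k$ be positive integers with $1\le a<b$ and $2\le k\le b$. If a finite simple graph $G$ satisfies $\delta(G)\geq a+n$ and $I(G)\geq a-1+\frac{a+kn-1}{b}$, then $$\delta_G(a,b;S)=b|S|-a|T|+d_{G-S}(T)\geq kn$$ for every subset $S\subseteq V(G)$ for which $T=\{x\in V(G)-S: d_{G-S}(x)\leq a-1\}$ is nonempty.
   Context: For $S\subseteq V(G)$, $i(G-S)$ is the number of isolated vertices of $G-S$. The isolated toughness is $I(G)=\min\{|S|/i(G-S): S\subseteq V(G),\ i(G-S)\geq 2\}$ if $G$ is not complete, and $I(G)=|V(G)|-1$ if $G$ is complete. For a vertex set $T$ of a graph $F$, $d_F(T)=\sum_{x\in T}d_F(x)$. -}

module Defs where

open import Data.Nat using (ℕ; zero; suc; _+_; _*_; _∸_; _≤_; _≤ᵇ_; _≡ᵇ_)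
open import Data.Bool using (Bool; true; false; not; _∧_; if_then_else_)
open import Data.Fin using (Fin)
open import Data.Fin.Subset using (Subset; ∣_∣; ⊥)
open import Data.Vec using (lookup; tabulate)
open import Data.Product using (_×_)
open import Data.Integer as ℤ using (ℤ; +_)
open import Relation.Binary.PropositionalEquality using (_≡_; _≢_)
open import Relation.Nullary using (¬_)

record Graph (m : ℕ) : Set where
  field
    Adj    : Fin m → Fin m → Bool
    symm   : ∀ x y → Adj x y ≡ Adj y x
    irrefl : ∀ x → Adj x x ≡ false
open Graph public

count : ∀ {m} → (Fin m → Bool) → ℕ
count {zero}  f = 0
count {suc m} f = (if f Fin.zero then 1 else 0) + count (λ x → f (Fin.suc x))

sumV : ∀ {m} → (Fin m → ℕ) → ℕ
sumV {zero}  f = 0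
sumV {suc m} f = f Fin.zero + sumV (λ x → f (Fin.suc x))

_∈ᵇ_ : ∀ {m} → Fin m → Subset m → Bool
x ∈ᵇ S = lookup S x

-- d_{G-S}(x): number of neighbours of x outside S (degree of x in G - S, for x ∉ S)
degIn : ∀ {m} → Graph m → Subset m → Fin m → ℕ
degIn G S x = count (λ y → not (y ∈ᵇ S) ∧ Adj G x y)

deg : ∀ {m} → Graph m → Fin m → ℕ
deg G x = degIn G ⊥ x

MinDegAtLeast : ∀ {m} → Graph m → ℕ → Set
MinDegAtLeast G d = ∀ x → d ≤ deg G x

isoCount : ∀ {m} → Graph m → Subset m → ℕ
isoCount G S = count (λ x → not (x ∈ᵇ S) ∧ (degIn G S x ≡ᵇ 0))

Complete : ∀ {m} → Graph m → Set
Complete G = ∀ x y → x ≢ y → Adj G x y ≡ true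

-- I(G) ≥ p / q  (q > 0 is supplied by the caller), unfolding the definition of I(G):
--  * if G is complete, I(G) = |V(G)| - 1, so the condition is (|V(G)| - 1) ≥ p/q;
--  * otherwise I(G) = min { |S| / i(G-S) : i(G-S) ≥ 2 }, so the condition is
--    |S| / i(G-S) ≥ p/q, i.e. p * i(G-S) ≤ q * |S|, for all S with i(G-S) ≥ 2.
IsoToughnessAtLeast : ∀ {m} → Graph m → ℕ → ℕ → Set
IsoToughnessAtLeast {m} G p q =
  (Complete G → + p ℤ.≤ (+ m ℤ.- + 1) ℤ.* + q) ×
  (¬ Complete G → ∀ (S : Subset m) → 2 ≤ isoCount G S → p * isoCount G S ≤ q * ∣ S ∣)

Tset : ∀ {m} → Graph m → Subset m → ℕ → Subset m
Tset G S a = tabulate (λ x → not (x ∈ᵇ S) ∧ (degIn G S x ≤ᵇ a ∸ 1))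

degSet : ∀ {m} → Graph m → Subset m → Subset m → ℕ
degSet G S T = sumV (λ x → if x ∈ᵇ T then degIn G S x else 0)

deltaG : ∀ {m} → Graph m → ℕ → ℕ → Subset m → ℤ
deltaG G a b S =
  (+ (b * ∣ S ∣) ℤ.- + (a * ∣ Tset G S a ∣)) ℤ.+ + degSet G S (Tset G S a)

-- Let d be the degree in G − S and T the vertices outside S with d < a, so that
-- a|T| − d_{G−S}(T) = Σ_{y∈T} (a − d y). Scanning T by increasing d, greedily pick an
-- independent set I ⊆ T in which every other vertex of T has a neighbour of no larger
-- degree; charging each vertex of T to such a neighbour bounds the sum by
-- H = Σ_{x∈I} (a − d x)(1 + d x). As δ ≥ a + n forces |S| ≥ a + n − d x, each term of H
-- is at most b|S| − kn, which settles |I| ≤ 1. If |I| ≥ 2, then I is a set of isolated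
-- vertices of G − (S ∪ N_{G−S}(I)), whose deleted set has size at most |S| + Σ_{x∈I} d x;
-- the isolated toughness bound then yields H + |I|(kn − 1) ≤ b|S|, and |I|(kn − 1) ≥ kn.
module Submission where

open import Defs
open import Data.Bool using (Bool; true; false; not; _∧_; _∨_; if_then_else_)
import Data.Bool as Bool
open import Data.Bool.Properties using (∧-zeroʳ; ∨-zeroʳ)
open import Data.Fin using (Fin; zero; suc; toℕ)
open import Data.Fin.Properties using (toℕ<n; toℕ-injective) renaming (suc-injective to fsuc-injective)
open import Data.Fin.Subset using (Subset; Nonempty; ∣_∣; ⊥)
import Data.Integer as ℤ
import Data.Integer.Properties as ℤP
open import Data.Integer.Tactic.RingSolver renaming (solve-∀ to ℤ-solve-∀)
open import Data.Nat using (ℕ; zero; suc; _+_; _*_; _∸_; _≤_; _<_; _≡ᵇ_; z≤n; s≤s; s≤s⁻¹)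
open import Data.Nat.Properties
open import Data.Nat.Tactic.RingSolver using (solve-∀)
open import Data.Product using (∃-syntax; _×_; _,_; proj₁; proj₂)
open import Data.Sum using (_⊎_; inj₁; inj₂)
open import Data.Vec using (_∷_; []; lookup; tabulate)
open import Data.Vec.Properties using (lookup∘tabulate; lookup-replicate; []=⇒lookup)
open import Function using (_∘_)
open import Relation.Binary.Definitions using (tri<; tri≈; tri>)
open import Relation.Binary.PropositionalEquality
open import Relation.Nullary using (¬_; yes; no; contradiction)
open import Algebra.Properties.CommutativeSemigroup *-commutativeSemigroup using (x∙yz≈y∙xz)
open import Algebra.Properties.Semiring.Sum +-*-semiring
  using (sum; sum-cong-≗; ∑-distrib-+; ∑-comm; *-distribˡ-sum; *-distribʳ-sum; sum-remove)

𝟙 : Bool → ℕ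
𝟙 b = if b then 1 else 0

𝟙-mono : ∀ {p q} → (p ≡ true → q ≡ true) → 𝟙 p ≤ 𝟙 q
𝟙-mono {false} _ = z≤n
𝟙-mono {true} p⇒q rewrite p⇒q refl = ≤-refl

𝟙-true* : ∀ {p} {n} → p ≡ true → 𝟙 p * n ≡ n
𝟙-true* refl = *-identityˡ _

𝟙-∨-≤ : ∀ p {q c} → 𝟙 q ≤ c → 𝟙 (p ∨ q) ≤ 𝟙 p + 𝟙 (not p) * c
𝟙-∨-≤ true _ = s≤s z≤n
𝟙-∨-≤ false {c = c} q≤c = ≤-trans q≤c (≤-reflexive (sym (*-identityˡ c)))

𝟙-nonzero≤ : ∀ c → 𝟙 (not (c ≡ᵇ 0)) ≤ c
𝟙-nonzero≤ zero = z≤n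
𝟙-nonzero≤ (suc c) = s≤s z≤n

𝟙-swap : ∀ p q r → 𝟙 p * 𝟙 (q ∧ r) ≡ 𝟙 q * 𝟙 (p ∧ r)
𝟙-swap false false r = refl
𝟙-swap false true r = refl
𝟙-swap true false r = refl
𝟙-swap true true r = refl

sumV≡sum : ∀ {m} (f : Fin m → ℕ) → sumV f ≡ sum f
sumV≡sum {zero} f = refl
sumV≡sum {suc m} f = cong (f zero +_) (sumV≡sum (f ∘ suc))

count≡sum𝟙 : ∀ {m} (p : Fin m → Bool) → count p ≡ sum (𝟙 ∘ p)
count≡sum𝟙 {zero} p = refl
count≡sum𝟙 {suc m} p = cong (𝟙 (p zero) +_) (count≡sum𝟙 (p ∘ suc))

∣p∣≡count : ∀ {m} (p : Subset m) → ∣ p ∣ ≡ count (_∈ᵇ p)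
∣p∣≡count [] = refl
∣p∣≡count (true ∷ p) = cong suc (∣p∣≡count p)
∣p∣≡count (false ∷ p) = ∣p∣≡count p

*-count : ∀ {m} c (p : Fin m → Bool) → c * count p ≡ sum (λ x → c * 𝟙 (p x))
*-count c p = trans (cong (c *_) (count≡sum𝟙 p)) (*-distribˡ-sum c (𝟙 ∘ p))

sum-mono-≤ : ∀ {m} {f g : Fin m → ℕ} → (∀ i → f i ≤ g i) → sum f ≤ sum g
sum-mono-≤ {zero} _ = z≤n
sum-mono-≤ {suc m} f≤g = +-mono-≤ (f≤g zero) (sum-mono-≤ (f≤g ∘ suc))

term≤sum : ∀ {m} (f : Fin m → ℕ) i → f i ≤ sum f
term≤sum {suc m} f i = ≤-trans (m≤m+n (f i) _) (≤-reflexive (sym (sum-remove {i = i} f)))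

count-mono : ∀ {m} {p q : Fin m → Bool} → (∀ x → p x ≡ true → q x ≡ true) → count p ≤ count q
count-mono {p = p} {q} p⊆q = begin
  count p         ≡⟨ count≡sum𝟙 p ⟩
  sum (𝟙 ∘ p)     ≤⟨ sum-mono-≤ (λ x → 𝟙-mono (p⊆q x)) ⟩
  sum (𝟙 ∘ q)     ≡⟨ count≡sum𝟙 q ⟨
  count q         ∎
  where open ≤-Reasoning

count-pos : ∀ {m} (p : Fin m → Bool) {x} → p x ≡ true → 1 ≤ count p
count-pos p {x} px = begin
  1               ≡⟨ cong 𝟙 px ⟨
  𝟙 (p x)         ≤⟨ term≤sum (𝟙 ∘ p) x ⟩
  sum (𝟙 ∘ p)     ≡⟨ count≡sum𝟙 p ⟨
  count p         ∎
  where open ≤-Reasoning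

count≡0 : ∀ {m} {p : Fin m → Bool} → (∀ x → p x ≡ false) → count p ≡ 0
count≡0 {zero} _ = refl
count≡0 {suc m} p≡false rewrite p≡false zero = count≡0 (p≡false ∘ suc)

count-witness : ∀ {m} (p : Fin m → Bool) → 1 ≤ count p → ∃[ x ] p x ≡ true
count-witness {suc m} p 1≤c with p zero in p0
... | true = zero , p0
... | false = let x , px = count-witness (p ∘ suc) 1≤c in suc x , px

count-two-witnesses : ∀ {m} (p : Fin m → Bool) → 2 ≤ count p →
  ∃[ x ] ∃[ y ] x ≢ y × p x ≡ true × p y ≡ true
count-two-witnesses {suc m} p 2≤c with p zero in p0
... | true = let y , py = count-witness (p ∘ suc) (s≤s⁻¹ 2≤c) in zero , suc y , (λ ()) , p0 , py
... | false = let x , y , x≢y , px , py = count-two-witnesses (p ∘ suc) 2≤c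
              in suc x , suc y , x≢y ∘ fsuc-injective , px , py

sumOver : ∀ {m} → (Fin m → Bool) → (Fin m → ℕ) → ℕ
sumOver p f = sum (λ x → 𝟙 (p x) * f x)

syntax sumOver p (λ x → e) = ∑[ x ∈ p ] e

sumOver-cong : ∀ {m} (p : Fin m → Bool) {f g : Fin m → ℕ} →
  (∀ x → p x ≡ true → f x ≡ g x) → ∑[ x ∈ p ] f x ≡ ∑[ x ∈ p ] g x
sumOver-cong p f≡g = sum-cong-≗ pointwise
  where
  pointwise : ∀ x → 𝟙 (p x) * _ ≡ 𝟙 (p x) * _
  pointwise x with p x in px
  ... | true = cong (_+ 0) (f≡g x px)
  ... | false = refl

sumOver-mono-≤ : ∀ {m} (p : Fin m → Bool) {f g : Fin m → ℕ} →
  (∀ x → p x ≡ true → f x ≤ g x) → ∑[ x ∈ p ] f x ≤ ∑[ x ∈ p ] g x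
sumOver-mono-≤ p f≤g = sum-mono-≤ pointwise
  where
  pointwise : ∀ x → 𝟙 (p x) * _ ≤ 𝟙 (p x) * _
  pointwise x with p x in px
  ... | true = +-monoˡ-≤ 0 (f≤g x px)
  ... | false = z≤n

sumOver-+ : ∀ {m} (p : Fin m → Bool) (f g : Fin m → ℕ) →
  ∑[ x ∈ p ] (f x + g x) ≡ ∑[ x ∈ p ] f x + ∑[ x ∈ p ] g x
sumOver-+ p f g = trans (sum-cong-≗ (λ x → *-distribˡ-+ (𝟙 (p x)) (f x) (g x)))
                        (∑-distrib-+ (λ x → 𝟙 (p x) * f x) (λ x → 𝟙 (p x) * g x))

sumOver-*ˡ : ∀ {m} (p : Fin m → Bool) c (f : Fin m → ℕ) →
  ∑[ x ∈ p ] (c * f x) ≡ c * ∑[ x ∈ p ] f x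
sumOver-*ˡ p c f = trans (sum-cong-≗ (λ x → x∙yz≈y∙xz (𝟙 (p x)) c (f x)))
                         (sym (*-distribˡ-sum c (λ x → 𝟙 (p x) * f x)))

sumOver-const : ∀ {m} (p : Fin m → Bool) c → ∑[ x ∈ p ] c ≡ count p * c
sumOver-const p c = trans (sym (*-distribʳ-sum c (𝟙 ∘ p))) (cong (_* c) (sym (count≡sum𝟙 p)))

sumOver-≤-count* : ∀ {m} (p : Fin m → Bool) {f : Fin m → ℕ} {B} →
  (∀ x → p x ≡ true → f x ≤ B) → ∑[ x ∈ p ] f x ≤ count p * B
sumOver-≤-count* p {B = B} f≤B = ≤-trans (sumOver-mono-≤ p f≤B) (≤-reflexive (sumOver-const p B))

≡ᵇ-true⇒≡ : ∀ {m n} → (m ≡ᵇ n) ≡ true → m ≡ n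
≡ᵇ-true⇒≡ {m} {n} e = ≡ᵇ⇒≡ m n (subst Bool.T (sym e) _)

≡ᵇ-refl : ∀ n → (n ≡ᵇ n) ≡ true
≡ᵇ-refl zero = refl
≡ᵇ-refl (suc n) = ≡ᵇ-refl n

not-≡-true : ∀ {b} → not b ≡ true → b ≡ false
not-≡-true {false} _ = refl

∧-≡-true : ∀ {p q} → p ∧ q ≡ true → p ≡ true × q ≡ true
∧-≡-true {true} q≡true = refl , q≡true

hasNbrIn : ∀ {m} → Graph m → (Fin m → Bool) → Fin m → Bool
hasNbrIn G F x = not (count (λ y → F y ∧ Adj G x y) ≡ᵇ 0)

module _ {m} (G : Graph m) (F : Fin m → Bool) where

  hasNbrIn-intro : ∀ {x y} → F y ≡ true → Adj G x y ≡ true → hasNbrIn G F x ≡ true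
  hasNbrIn-intro {x} {y} Fy xy = positive (count-pos (λ z → F z ∧ Adj G x z) (cong₂ _∧_ Fy xy))
    where
    positive : ∀ {c} → 1 ≤ c → not (c ≡ᵇ 0) ≡ true
    positive (s≤s _) = refl

  hasNbrIn-elim : ∀ {x} → hasNbrIn G F x ≡ true → ∃[ y ] F y ≡ true × Adj G x y ≡ true
  hasNbrIn-elim {x} has = let y , Fy∧xy = count-witness _ (positive has) in y , ∧-≡-true Fy∧xy
    where
    positive : ∀ {c} → not (c ≡ᵇ 0) ≡ true → 1 ≤ c
    positive {suc _} _ = s≤s z≤n

  hasNbrIn-false : ∀ {x y} → hasNbrIn G F x ≡ false → F y ≡ true → Adj G x y ≡ false
  hasNbrIn-false {x} {y} none Fy with Adj G x y in xy
  ... | false = refl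
  ... | true with () ← trans (sym none) (hasNbrIn-intro Fy xy)

  noNbr⇒hasNbrIn-false : ∀ {x} → (∀ {y} → F y ≡ true → Adj G x y ≡ false) → hasNbrIn G F x ≡ false
  noNbr⇒hasNbrIn-false {x} noNbr = cong (λ c → not (c ≡ᵇ 0)) (count≡0 pointwise)
    where
    pointwise : ∀ y → F y ∧ Adj G x y ≡ false
    pointwise y with F y in Fy
    ... | true = noNbr Fy
    ... | false = refl

Independent : ∀ {m} → Graph m → (Fin m → Bool) → Set
Independent G I = ∀ {x y} → I x ≡ true → I y ≡ true → Adj G x y ≡ false

Dominates : ∀ {m} → Graph m → (Fin m → ℕ) → (Fin m → Bool) → (Fin m → Bool) → Set
Dominates G w I P = ∀ {y} → P y ≡ true → I y ≡ false →
  ∃[ x ] I x ≡ true × Adj G y x ≡ true × w x ≤ w y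

record DominatingIndependentSet {m} (G : Graph m) (w : Fin m → ℕ) (P : Fin m → Bool) : Set where
  field
    I : Fin m → Bool
    I⊆P : ∀ {x} → I x ≡ true → P x ≡ true
    independent : Independent G I
    dominates : Dominates G w I P

module Greedy {m} (G : Graph m) (P : Fin m → Bool) (rank : Fin m → ℕ)
              (rank-injective : ∀ {x y} → rank x ≡ rank y → x ≡ y) where

  chosen : ℕ → Fin m → Bool
  chosen zero _ = false
  chosen (suc n) x = chosen n x ∨ ((rank x ≡ᵇ n) ∧ P x ∧ not (hasNbrIn G (chosen n) x))

  chosen-suc⁺ : ∀ {n x} → chosen n x ≡ true → chosen (suc n) x ≡ true
  chosen-suc⁺ old rewrite old = refl

  chosen-suc⁻ : ∀ {n x} → chosen (suc n) x ≡ true →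
    chosen n x ≡ true ⊎ (rank x ≡ n × P x ≡ true × hasNbrIn G (chosen n) x ≡ false)
  chosen-suc⁻ {n} {x} new with chosen n x
  ... | true = inj₁ refl
  ... | false with rank≡n , rest ← ∧-≡-true new with Px , none ← ∧-≡-true rest =
    inj₂ (≡ᵇ-true⇒≡ rank≡n , Px , not-≡-true none)

  chosen⇒rank<×P : ∀ {n x} → chosen n x ≡ true → rank x < n × P x ≡ true
  chosen⇒rank<×P {suc n} x∈ with chosen-suc⁻ x∈
  ... | inj₁ old = let r , Px = chosen⇒rank<×P old in m<n⇒m<1+n r , Px
  ... | inj₂ (refl , Px , _) = ≤-refl , Px

  chosen-independent : ∀ n → Independent G (chosen n)
  chosen-independent (suc n) x∈ y∈ with chosen-suc⁻ x∈ | chosen-suc⁻ y∈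
  ... | inj₁ x-old | inj₁ y-old = chosen-independent n x-old y-old
  ... | inj₁ x-old | inj₂ (_ , _ , y-isolated) =
    trans (symm G _ _) (hasNbrIn-false G (chosen n) y-isolated x-old)
  ... | inj₂ (_ , _ , x-isolated) | inj₁ y-old = hasNbrIn-false G (chosen n) x-isolated y-old
  ... | inj₂ (rx , _) | inj₂ (ry , _) rewrite rank-injective (trans rx (sym ry)) = irrefl G _

  chosen-dominates : ∀ n {y} → P y ≡ true → rank y < n → chosen n y ≡ false →
    ∃[ x ] chosen n x ≡ true × Adj G y x ≡ true × rank x < rank y
  chosen-dominates (suc n) {y} Py y<n y∉ with chosen n y in y-old
  ... | true with () ← y∉
  ... | false with m<1+n⇒m<n∨m≡n y<n
  ...   | inj₁ y<n′ = let x , x∈ , yx , x<y = chosen-dominates n Py y<n′ y-old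
                      in x , chosen-suc⁺ x∈ , yx , x<y
  ...   | inj₂ refl = let x , x∈ , yx = hasNbrIn-elim G (chosen n) (rejected y∉ (≡ᵇ-refl (rank y)) Py)
                      in x , chosen-suc⁺ x∈ , yx , proj₁ (chosen⇒rank<×P x∈)
    where
    rejected : ∀ {r p h} → r ∧ p ∧ not h ≡ false → r ≡ true → p ≡ true → h ≡ true
    rejected {h = true} _ _ _ = refl
    rejected {h = false} () refl refl

-- Ties in the weight are broken by the vertex index, making the rank injective.
lexRank : ∀ {m} → (Fin m → ℕ) → Fin m → ℕ
lexRank {m} w x = w x * m + toℕ x

module _ {m} (w : Fin m → ℕ) where

  lexRank<[1+w]*m : ∀ x → lexRank w x < suc (w x) * m
  lexRank<[1+w]*m x = begin-strict
    w x * m + toℕ x   <⟨ +-monoʳ-< (w x * m) (toℕ<n x) ⟩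
    w x * m + m       ≡⟨ +-comm (w x * m) m ⟩
    suc (w x) * m     ∎
    where open ≤-Reasoning

  lexRank-mono-< : ∀ {x y} → w x < w y → lexRank w x < lexRank w y
  lexRank-mono-< {x} {y} wx<wy = begin-strict
    lexRank w x       <⟨ lexRank<[1+w]*m x ⟩
    suc (w x) * m     ≤⟨ *-monoˡ-≤ m wx<wy ⟩
    w y * m           ≤⟨ m≤m+n (w y * m) (toℕ y) ⟩
    lexRank w y       ∎
    where open ≤-Reasoning

  lexRank<⇒w≤ : ∀ {x y} → lexRank w x < lexRank w y → w x ≤ w y
  lexRank<⇒w≤ {x} {y} rx<ry with w x ≤? w y
  ... | yes wx≤wy = wx≤wy
  ... | no wx≰wy = contradiction rx<ry (<-asym (lexRank-mono-< (≰⇒> wx≰wy)))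

  lexRank-injective : ∀ {x y} → lexRank w x ≡ lexRank w y → x ≡ y
  lexRank-injective {x} {y} rx≡ry with <-cmp (w x) (w y)
  ... | tri< wx<wy _ _ = contradiction rx≡ry (<⇒≢ (lexRank-mono-< wx<wy))
  ... | tri> _ _ wx>wy = contradiction (sym rx≡ry) (<⇒≢ (lexRank-mono-< wx>wy))
  ... | tri≈ _ wx≡wy _ =
    toℕ-injective (+-cancelˡ-≡ (w x * m) _ _ (trans rx≡ry (cong (λ v → v * m + toℕ y) (sym wx≡wy))))

  lexRank<bound : ∀ x → lexRank w x < suc (sum w) * m
  lexRank<bound x = <-≤-trans (lexRank<[1+w]*m x) (*-monoˡ-≤ m (s≤s (term≤sum w x)))

dominatingIndependentSet : ∀ {m} (G : Graph m) (w : Fin m → ℕ) (P : Fin m → Bool) →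
  DominatingIndependentSet G w P
dominatingIndependentSet {m} G w P = record
  { I = chosen N
  ; I⊆P = λ x∈ → proj₂ (chosen⇒rank<×P {N} x∈)
  ; independent = chosen-independent N
  ; dominates = λ Py y∉ → let x , x∈ , yx , x<y = chosen-dominates N Py (lexRank<bound w _) y∉
                          in x , x∈ , yx , lexRank<⇒w≤ w x<y
  }
  where
  open Greedy G P (lexRank w) (lexRank-injective w)
  N = suc (sum w) * m

-- Each y ∈ P ∖ I is charged to a dominating neighbour x ∈ I, which can afford f (d y) ≤ f (d x);
-- each x is charged by at most d x vertices.
charging : ∀ {m} (G : Graph m) (S : Subset m) {P I : Fin m → Bool} (f : ℕ → ℕ) →
  (∀ {u v} → u ≤ v → f v ≤ f u) →
  (∀ {y} → P y ≡ true → y ∈ᵇ S ≡ false) →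
  Dominates G (degIn G S) I P →
  ∑[ y ∈ P ] f (degIn G S y) ≤ ∑[ x ∈ I ] (f (degIn G S x) * suc (degIn G S x))
charging {m} G S {P} {I} f f-antitone P∩S≡∅ dominates = begin
  ∑[ y ∈ P ] f (d y)
    ≤⟨ sum-mono-≤ charged ⟩
  sum (λ y → 𝟙 (I y) * f (d y) + sum (charge y))
    ≡⟨ ∑-distrib-+ (λ y → 𝟙 (I y) * f (d y)) (λ y → sum (charge y)) ⟩
  ∑[ x ∈ I ] f (d x) + sum (λ y → sum (charge y))
    ≡⟨ cong (∑[ x ∈ I ] f (d x) +_) (trans (∑-comm charge) (sum-cong-≗ received)) ⟩
  ∑[ x ∈ I ] f (d x) + ∑[ x ∈ I ] (d x * f (d x))
    ≡⟨ sumOver-+ I (f ∘ d) (λ x → d x * f (d x)) ⟨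
  ∑[ x ∈ I ] (f (d x) + d x * f (d x))
    ≡⟨ sumOver-cong I (λ x _ → trans (cong (f (d x) +_) (*-comm (d x) (f (d x))))
                                      (sym (*-suc (f (d x)) (d x)))) ⟩
  ∑[ x ∈ I ] (f (d x) * suc (d x)) ∎
  where
  open ≤-Reasoning
  d : Fin m → ℕ
  d = degIn G S

  charge : Fin m → Fin m → ℕ
  charge y x = 𝟙 (I x) * (𝟙 (not (y ∈ᵇ S) ∧ Adj G x y) * f (d x))

  received : ∀ x → sum (λ y → charge y x) ≡ 𝟙 (I x) * (d x * f (d x))
  received x = begin-equality
    sum (λ y → charge y x)
      ≡⟨ *-distribˡ-sum (𝟙 (I x)) (λ y → 𝟙 (not (y ∈ᵇ S) ∧ Adj G x y) * f (d x)) ⟨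
    𝟙 (I x) * sum (λ y → 𝟙 (not (y ∈ᵇ S) ∧ Adj G x y) * f (d x))
      ≡⟨ cong (𝟙 (I x) *_) (*-distribʳ-sum (f (d x)) (λ y → 𝟙 (not (y ∈ᵇ S) ∧ Adj G x y))) ⟨
    𝟙 (I x) * (sum (λ y → 𝟙 (not (y ∈ᵇ S) ∧ Adj G x y)) * f (d x))
      ≡⟨ cong (λ c → 𝟙 (I x) * (c * f (d x))) (count≡sum𝟙 (λ y → not (y ∈ᵇ S) ∧ Adj G x y)) ⟨
    𝟙 (I x) * (d x * f (d x)) ∎

  charged : ∀ y → 𝟙 (P y) * f (d y) ≤ 𝟙 (I y) * f (d y) + sum (charge y)
  charged y with P y in Py | I y in Iy
  ... | false | _ = z≤n
  ... | true | true = m≤m+n (1 * f (d y)) _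
  ... | true | false = let x , Ix , yx , dx≤dy = dominates Py Iy in begin
    1 * f (d y)     ≡⟨ *-identityˡ (f (d y)) ⟩
    f (d y)         ≤⟨ f-antitone dx≤dy ⟩
    f (d x)         ≡⟨ paid Ix yx ⟨
    charge y x      ≤⟨ term≤sum (charge y) x ⟩
    sum (charge y)  ∎
    where
    paid : ∀ {x} → I x ≡ true → Adj G y x ≡ true → charge y x ≡ f (d x)
    paid {x} Ix yx =
      trans (𝟙-true* Ix) (𝟙-true* (cong₂ _∧_ (cong not (P∩S≡∅ Py)) (trans (symm G x y) yx)))

∣tabulate∣≡count : ∀ {m} (p : Fin m → Bool) → ∣ tabulate p ∣ ≡ count p
∣tabulate∣≡count {zero} p = refl
∣tabulate∣≡count {suc m} p with p zero
... | true = cong suc (∣tabulate∣≡count (p ∘ suc))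
... | false = ∣tabulate∣≡count (p ∘ suc)

withNbrs : ∀ {m} → Graph m → Subset m → (Fin m → Bool) → Subset m
withNbrs G S I = tabulate (λ y → y ∈ᵇ S ∨ hasNbrIn G I y)

module _ {m} (G : Graph m) (S : Subset m) (I : Fin m → Bool) where

  ∣withNbrs∣≤ : ∣ withNbrs G S I ∣ ≤ ∣ S ∣ + ∑[ x ∈ I ] degIn G S x
  ∣withNbrs∣≤ = begin
    ∣ withNbrs G S I ∣
      ≡⟨ ∣tabulate∣≡count (λ y → y ∈ᵇ S ∨ hasNbrIn G I y) ⟩
    count (λ y → y ∈ᵇ S ∨ hasNbrIn G I y)
      ≡⟨ count≡sum𝟙 (λ y → y ∈ᵇ S ∨ hasNbrIn G I y) ⟩
    sum (λ y → 𝟙 (y ∈ᵇ S ∨ hasNbrIn G I y))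
      ≤⟨ sum-mono-≤ (λ y → 𝟙-∨-≤ (y ∈ᵇ S) (𝟙-nonzero≤ (nbrs y))) ⟩
    sum (λ y → 𝟙 (y ∈ᵇ S) + 𝟙 (not (y ∈ᵇ S)) * nbrs y)
      ≡⟨ ∑-distrib-+ (λ y → 𝟙 (y ∈ᵇ S)) (λ y → 𝟙 (not (y ∈ᵇ S)) * nbrs y) ⟩
    sum (λ y → 𝟙 (y ∈ᵇ S)) + sum (λ y → 𝟙 (not (y ∈ᵇ S)) * nbrs y)
      ≡⟨ cong₂ _+_ (sym (trans (∣p∣≡count S) (count≡sum𝟙 (_∈ᵇ S)))) double-count ⟩
    ∣ S ∣ + ∑[ x ∈ I ] degIn G S x ∎
    where
    open ≤-Reasoning
    nbrs : Fin m → ℕ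
    nbrs y = count (λ x → I x ∧ Adj G y x)

    swap : ∀ x y →
      𝟙 (not (y ∈ᵇ S)) * 𝟙 (I x ∧ Adj G y x) ≡ 𝟙 (I x) * 𝟙 (not (y ∈ᵇ S) ∧ Adj G x y)
    swap x y = trans (𝟙-swap (not (y ∈ᵇ S)) (I x) (Adj G y x))
                     (cong (λ e → 𝟙 (I x) * 𝟙 (not (y ∈ᵇ S) ∧ e)) (symm G y x))

    double-count : sum (λ y → 𝟙 (not (y ∈ᵇ S)) * nbrs y) ≡ ∑[ x ∈ I ] degIn G S x
    double-count = begin-equality
      sum (λ y → 𝟙 (not (y ∈ᵇ S)) * nbrs y)
        ≡⟨ sum-cong-≗ (λ y → *-count (𝟙 (not (y ∈ᵇ S))) (λ x → I x ∧ Adj G y x)) ⟩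
      sum (λ y → sum (λ x → 𝟙 (not (y ∈ᵇ S)) * 𝟙 (I x ∧ Adj G y x)))
        ≡⟨ ∑-comm (λ y x → 𝟙 (not (y ∈ᵇ S)) * 𝟙 (I x ∧ Adj G y x)) ⟩
      sum (λ x → sum (λ y → 𝟙 (not (y ∈ᵇ S)) * 𝟙 (I x ∧ Adj G y x)))
        ≡⟨ sum-cong-≗ (λ x → sum-cong-≗ (λ y → swap x y)) ⟩
      sum (λ x → sum (λ y → 𝟙 (I x) * 𝟙 (not (y ∈ᵇ S) ∧ Adj G x y)))
        ≡⟨ sum-cong-≗ (λ x → *-count (𝟙 (I x)) (λ y → not (y ∈ᵇ S) ∧ Adj G x y)) ⟨
      ∑[ x ∈ I ] degIn G S x ∎

  count≤isoCount : Independent G I → (∀ {x} → I x ≡ true → x ∈ᵇ S ≡ false) →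
    count I ≤ isoCount G (withNbrs G S I)
  count≤isoCount independent I∩S≡∅ = count-mono isolated
    where
    isolated : ∀ x → I x ≡ true →
      not (x ∈ᵇ withNbrs G S I) ∧ (degIn G (withNbrs G S I) x ≡ᵇ 0) ≡ true
    isolated x Ix = cong₂ (λ s c → not s ∧ (c ≡ᵇ 0)) x∉ (count≡0 nbr∈)
      where
      x∉ : x ∈ᵇ withNbrs G S I ≡ false
      x∉ = trans (lookup∘tabulate _ x)
                 (cong₂ _∨_ (I∩S≡∅ Ix) (noNbr⇒hasNbrIn-false G I (independent Ix)))
      nbr∈ : ∀ y → not (y ∈ᵇ withNbrs G S I) ∧ Adj G x y ≡ false
      nbr∈ y with Adj G x y in xy
      ... | false = ∧-zeroʳ _
      ... | true = cong (λ s → not s ∧ true) (trans (lookup∘tabulate _ y) (trans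
                     (cong (y ∈ᵇ S ∨_) (hasNbrIn-intro G I Ix (trans (symm G y x) xy)))
                     (∨-zeroʳ _)))

independent⇒¬Complete : ∀ {m} {G : Graph m} {I : Fin m → Bool} →
  Independent G I → 2 ≤ count I → ¬ Complete G
independent⇒¬Complete {I = I} independent 2≤∣I∣ complete =
  let x , y , x≢y , Ix , Iy = count-two-witnesses I 2≤∣I∣
  in contradiction (trans (sym (complete x y x≢y)) (independent Ix Iy)) λ ()

-- The isolated vertices of G - (S ∪ N_{G-S}(I)) include I.
isoToughness-bound : ∀ {m} {G : Graph m} {p b} → IsoToughnessAtLeast G p b →
  ∀ S {I} → Independent G I → (∀ {x} → I x ≡ true → x ∈ᵇ S ≡ false) → 2 ≤ count I →
  count I * p ≤ b * (∣ S ∣ + ∑[ x ∈ I ] degIn G S x)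
isoToughness-bound {G = G} {p} {b} (_ , tough) S {I} independent I∩S≡∅ 2≤∣I∣ = begin
  count I * p                    ≡⟨ *-comm (count I) p ⟩
  p * count I                    ≤⟨ *-monoʳ-≤ p I≤iso ⟩
  p * isoCount G S′              ≤⟨ tough ¬complete S′ (≤-trans 2≤∣I∣ I≤iso) ⟩
  b * ∣ S′ ∣                     ≤⟨ *-monoʳ-≤ b (∣withNbrs∣≤ G S I) ⟩
  b * (∣ S ∣ + ∑[ x ∈ I ] degIn G S x) ∎
  where
  open ≤-Reasoning
  S′ = withNbrs G S I
  I≤iso = count≤isoCount G S I independent I∩S≡∅
  ¬complete = independent⇒¬Complete {G = G} independent 2≤∣I∣

deg≤∣S∣+degIn : ∀ {m} (G : Graph m) (S : Subset m) x → deg G x ≤ ∣ S ∣ + degIn G S x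
deg≤∣S∣+degIn {m} G S x = begin
  deg G x
    ≡⟨ count≡sum𝟙 (λ y → not (y ∈ᵇ ⊥) ∧ Adj G x y) ⟩
  sum (λ y → 𝟙 (not (y ∈ᵇ ⊥) ∧ Adj G x y))
    ≡⟨ sum-cong-≗ (λ y → cong (λ s → 𝟙 (not s ∧ Adj G x y)) (lookup-replicate y false)) ⟩
  sum (λ y → 𝟙 (Adj G x y))
    ≤⟨ sum-mono-≤ (λ y → split (y ∈ᵇ S) (Adj G x y)) ⟩
  sum (λ y → 𝟙 (y ∈ᵇ S) + 𝟙 (not (y ∈ᵇ S) ∧ Adj G x y))
    ≡⟨ ∑-distrib-+ (λ y → 𝟙 (y ∈ᵇ S)) (λ y → 𝟙 (not (y ∈ᵇ S) ∧ Adj G x y)) ⟩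
  sum (λ y → 𝟙 (y ∈ᵇ S)) + sum (λ y → 𝟙 (not (y ∈ᵇ S) ∧ Adj G x y))
    ≡⟨ cong₂ _+_ (trans (∣p∣≡count S) (count≡sum𝟙 (_∈ᵇ S)))
                 (count≡sum𝟙 (λ y → not (y ∈ᵇ S) ∧ Adj G x y)) ⟨
  ∣ S ∣ + degIn G S x ∎
  where
  open ≤-Reasoning
  split : ∀ s q → 𝟙 q ≤ 𝟙 s + 𝟙 (not s ∧ q)
  split true true = s≤s z≤n
  split true false = z≤n
  split false q = ≤-refl

degSet≡sumOver : ∀ {m} (G : Graph m) (S T : Subset m) →
  degSet G S T ≡ ∑[ x ∈ (_∈ᵇ T) ] degIn G S x
degSet≡sumOver G S T = trans (sumV≡sum (λ x → if x ∈ᵇ T then degIn G S x else 0))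
                             (sum-cong-≗ (λ x → if-then-0 (x ∈ᵇ T)))
  where
  if-then-0 : ∀ b {c} → (if b then c else 0) ≡ 𝟙 b * c
  if-then-0 true = sym (*-identityˡ _)
  if-then-0 false = refl

module _ {m} (G : Graph m) (S : Subset m) (a : ℕ) where

  Tset-member : ∀ {x} → x ∈ᵇ Tset G S a ≡ true → x ∈ᵇ S ≡ false × degIn G S x ≤ a ∸ 1
  Tset-member {x} x∈T with x∉S , small ← ∧-≡-true (trans (sym (lookup∘tabulate _ x)) x∈T) =
    not-≡-true x∉S , ≤ᵇ⇒≤ _ _ (subst Bool.T (sym small) _)

  a*∣Tset∣≡deficiency+degSet : a * ∣ Tset G S a ∣ ≡
    ∑[ y ∈ (_∈ᵇ Tset G S a) ] (a ∸ degIn G S y) + degSet G S (Tset G S a)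
  a*∣Tset∣≡deficiency+degSet = begin
    a * ∣ T ∣
      ≡⟨ *-comm a ∣ T ∣ ⟩
    ∣ T ∣ * a
      ≡⟨ cong (_* a) (∣p∣≡count T) ⟩
    count (_∈ᵇ T) * a
      ≡⟨ sumOver-const (_∈ᵇ T) a ⟨
    ∑[ y ∈ (_∈ᵇ T) ] a
      ≡⟨ sumOver-cong (_∈ᵇ T) (λ y y∈T → sym (m∸n+n≡m (≤-trans (proj₂ (Tset-member y∈T)) (m∸n≤m a 1)))) ⟩
    ∑[ y ∈ (_∈ᵇ T) ] (a ∸ d y + d y)
      ≡⟨ sumOver-+ (_∈ᵇ T) (λ y → a ∸ d y) d ⟩
    ∑[ y ∈ (_∈ᵇ T) ] (a ∸ d y) + ∑[ y ∈ (_∈ᵇ T) ] d y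
      ≡⟨ cong (∑[ y ∈ (_∈ᵇ T) ] (a ∸ d y) +_) (degSet≡sumOver G S T) ⟨
    ∑[ y ∈ (_∈ᵇ T) ] (a ∸ d y) + degSet G S T ∎
    where
    open ≡-Reasoning
    T = Tset G S a
    d = degIn G S

vertexCost≤ : ∀ {a b d k n s} → d < a → a < b → k ≤ b → a + n ≤ s + d →
  (a ∸ d) * suc d + k * n ≤ b * s
vertexCost≤ {a} {b} {d} {k} {n} {s} d<a a<b k≤b a+n≤s+d = begin
  (a ∸ d) * suc d + k * n  ≤⟨ +-mono-≤ (*-monoʳ-≤ (a ∸ d) (<-trans d<a a<b)) (*-monoˡ-≤ n k≤b) ⟩
  (a ∸ d) * b + b * n      ≡⟨ cong (_+ b * n) (*-comm (a ∸ d) b) ⟩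
  b * (a ∸ d) + b * n      ≡⟨ *-distribˡ-+ b (a ∸ d) n ⟨
  b * (a ∸ d + n)          ≤⟨ *-monoʳ-≤ b a∸d+n≤s ⟩
  b * s                    ∎
  where
  open ≤-Reasoning
  a∸d+n≤s : a ∸ d + n ≤ s
  a∸d+n≤s = begin
    a ∸ d + n    ≡⟨ +-∸-comm n (<⇒≤ d<a) ⟨
    a + n ∸ d    ≤⟨ ∸-monoˡ-≤ d a+n≤s+d ⟩
    s + d ∸ d    ≡⟨ m+n∸n≡m s d ⟩
    s            ∎

vertexCost+degree≤ : ∀ {a b d c} → d < a → a < b → 1 ≤ c →
  (a ∸ d) * suc d + b * d + (c ∸ 1) ≤ (a ∸ 1) * b + (a + c ∸ 1)
vertexCost+degree≤ {suc α} {b} {d} {suc q} (s≤s d≤α) a<b _ = begin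
  (suc α ∸ d) * suc d + b * d + q    ≡⟨ cong (λ e → e * suc d + b * d + q) (+-∸-assoc 1 d≤α) ⟩
  suc f * suc d + b * d + q          ≡⟨ rearrange₁ f d b q ⟩
  f * d + (f + d + suc q + b * d)    ≤⟨ +-monoˡ-≤ (f + d + suc q + b * d) (*-monoʳ-≤ f d≤b) ⟩
  f * b + (f + d + suc q + b * d)    ≡⟨ rearrange₂ f d b q ⟩
  (f + d) * b + (f + d + suc q)      ≡⟨ cong (λ e → e * b + (e + suc q)) (m∸n+n≡m d≤α) ⟩
  α * b + (α + suc q)                ∎
  where
  open ≤-Reasoning
  f = α ∸ d
  d≤b : d ≤ b
  d≤b = ≤-trans (m≤n⇒m≤1+n d≤α) (<⇒≤ a<b)
  rearrange₁ : ∀ f d b q → suc f * suc d + b * d + q ≡ f * d + (f + d + suc q + b * d)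
  rearrange₁ = solve-∀
  rearrange₂ : ∀ f d b q → f * b + (f + d + suc q + b * d) ≡ (f + d) * b + (f + d + suc q)
  rearrange₂ = solve-∀

m≤j*[m∸1] : ∀ {j m} → 2 ≤ j → 2 ≤ m → m ≤ j * (m ∸ 1)
m≤j*[m∸1] {j} {suc m} 2≤j (s≤s 1≤m) = begin
  1 + m      ≤⟨ +-monoˡ-≤ m 1≤m ⟩
  m + m      ≡⟨ cong (m +_) (+-identityʳ m) ⟨
  2 * m      ≤⟨ *-monoˡ-≤ m 2≤j ⟩
  j * m      ∎
  where open ≤-Reasoning

module _ {a b n k m} (1≤a : 1 ≤ a) (a<b : a < b) (1≤n : 1 ≤ n) (2≤k : 2 ≤ k) (k≤b : k ≤ b)
         (G : Graph m) (δ≥a+n : MinDegAtLeast G (a + n))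
         (tough : IsoToughnessAtLeast G ((a ∸ 1) * b + (a + k * n ∸ 1)) b) (S : Subset m) where

  private
    d : Fin m → ℕ
    d = degIn G S

    T : Subset m
    T = Tset G S a

    kn : ℕ
    kn = k * n

  open DominatingIndependentSet (dominatingIndependentSet G d (_∈ᵇ T))

  private
    H : ℕ
    H = ∑[ x ∈ I ] ((a ∸ d x) * suc (d x))

    T-member : ∀ {x} → x ∈ᵇ T ≡ true → x ∈ᵇ S ≡ false × d x < a
    T-member x∈T with x∉S , dx≤a∸1 ← Tset-member G S a x∈T =
      x∉S , ≤-trans (s≤s dx≤a∸1) (≤-reflexive (m+[n∸m]≡n 1≤a))

    vertexCost : ∀ {x} → x ∈ᵇ T ≡ true → (a ∸ d x) * suc (d x) + kn ≤ b * ∣ S ∣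
    vertexCost {x} x∈T =
      vertexCost≤ (proj₂ (T-member x∈T)) a<b k≤b (≤-trans (δ≥a+n x) (deg≤∣S∣+degIn G S x))

    deficiency≤H : ∑[ y ∈ (_∈ᵇ T) ] (a ∸ d y) ≤ H
    deficiency≤H = charging G S (a ∸_) (∸-monoʳ-≤ a) (proj₁ ∘ T-member) dominates

    kn+H≤b∣S∣-few : count I ≤ 1 → Nonempty T → kn + H ≤ b * ∣ S ∣
    kn+H≤b∣S∣-few ∣I∣≤1 (y₀ , y₀∈T) = begin
      kn + H
        ≤⟨ +-monoʳ-≤ kn (sumOver-≤-count* I (λ _ x∈I → m+n≤o⇒m≤o∸n _ (vertexCost (I⊆P x∈I)))) ⟩
      kn + count I * (b * ∣ S ∣ ∸ kn)
        ≤⟨ +-monoʳ-≤ kn (*-monoˡ-≤ (b * ∣ S ∣ ∸ kn) ∣I∣≤1) ⟩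
      kn + 1 * (b * ∣ S ∣ ∸ kn)
        ≡⟨ cong (kn +_) (*-identityˡ (b * ∣ S ∣ ∸ kn)) ⟩
      kn + (b * ∣ S ∣ ∸ kn)
        ≡⟨ m+[n∸m]≡n (m+n≤o⇒n≤o ((a ∸ d y₀) * suc (d y₀)) (vertexCost ([]=⇒lookup y₀∈T))) ⟩
      b * ∣ S ∣ ∎
      where open ≤-Reasoning

    kn+H≤b∣S∣-many : 2 ≤ count I → kn + H ≤ b * ∣ S ∣
    kn+H≤b∣S∣-many 2≤j = begin
      kn + H             ≤⟨ +-monoˡ-≤ H (m≤j*[m∸1] 2≤j 2≤kn) ⟩
      j * (kn ∸ 1) + H   ≤⟨ +-cancelʳ-≤ (b * D) _ _ with-D ⟩
      b * ∣ S ∣          ∎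
      where
      open ≤-Reasoning
      j = count I
      D = ∑[ x ∈ I ] d x
      p = (a ∸ 1) * b + (a + kn ∸ 1)

      2≤kn : 2 ≤ kn
      2≤kn = *-mono-≤ 2≤k 1≤n

      cost : Fin m → ℕ
      cost x = (a ∸ d x) * suc (d x) + b * d x + (kn ∸ 1)

      ∑cost≡ : ∑[ x ∈ I ] cost x ≡ H + b * D + j * (kn ∸ 1)
      ∑cost≡ = begin-equality
        ∑[ x ∈ I ] cost x
          ≡⟨ sumOver-+ I (λ x → (a ∸ d x) * suc (d x) + b * d x) (λ _ → kn ∸ 1) ⟩
        ∑[ x ∈ I ] ((a ∸ d x) * suc (d x) + b * d x) + ∑[ x ∈ I ] (kn ∸ 1)
          ≡⟨ cong₂ _+_ (sumOver-+ I (λ x → (a ∸ d x) * suc (d x)) (λ x → b * d x))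
                       (sumOver-const I (kn ∸ 1)) ⟩
        H + ∑[ x ∈ I ] (b * d x) + j * (kn ∸ 1)
          ≡⟨ cong (λ e → H + e + j * (kn ∸ 1)) (sumOver-*ˡ I b d) ⟩
        H + b * D + j * (kn ∸ 1) ∎

      with-D : j * (kn ∸ 1) + H + b * D ≤ b * ∣ S ∣ + b * D
      with-D = begin
        j * (kn ∸ 1) + H + b * D
          ≡⟨ rotate (j * (kn ∸ 1)) H (b * D) ⟩
        H + b * D + j * (kn ∸ 1)
          ≡⟨ ∑cost≡ ⟨
        ∑[ x ∈ I ] cost x
          ≤⟨ sumOver-≤-count* I (λ _ x∈I →
               vertexCost+degree≤ (proj₂ (T-member (I⊆P x∈I))) a<b (≤-trans (s≤s z≤n) 2≤kn)) ⟩
        j * p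
          ≤⟨ isoToughness-bound {G = G} tough S independent (λ x∈I → proj₁ (T-member (I⊆P x∈I))) 2≤j ⟩
        b * (∣ S ∣ + D)
          ≡⟨ *-distribˡ-+ b ∣ S ∣ D ⟩
        b * ∣ S ∣ + b * D ∎
        where
        rotate : ∀ u v w → u + v + w ≡ v + w + u
        rotate = solve-∀

    kn+H≤b∣S∣ : Nonempty T → kn + H ≤ b * ∣ S ∣
    kn+H≤b∣S∣ T≢∅ with 2 ≤? count I
    ... | yes 2≤∣I∣ = kn+H≤b∣S∣-many 2≤∣I∣
    ... | no 2≰∣I∣ = kn+H≤b∣S∣-few (s≤s⁻¹ (≰⇒> 2≰∣I∣)) T≢∅

  kn+a∣T∣≤b∣S∣+degSet : Nonempty T → k * n + a * ∣ T ∣ ≤ b * ∣ S ∣ + degSet G S T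
  kn+a∣T∣≤b∣S∣+degSet T≢∅ = begin
    kn + a * ∣ T ∣
      ≡⟨ cong (kn +_) (a*∣Tset∣≡deficiency+degSet G S a) ⟩
    kn + (∑[ y ∈ (_∈ᵇ T) ] (a ∸ d y) + degSet G S T)
      ≡⟨ +-assoc kn (∑[ y ∈ (_∈ᵇ T) ] (a ∸ d y)) (degSet G S T) ⟨
    kn + ∑[ y ∈ (_∈ᵇ T) ] (a ∸ d y) + degSet G S T
      ≤⟨ +-monoˡ-≤ (degSet G S T) (+-monoʳ-≤ kn deficiency≤H) ⟩
    kn + H + degSet G S T
      ≤⟨ +-monoˡ-≤ (degSet G S T) (kn+H≤b∣S∣ T≢∅) ⟩
    b * ∣ S ∣ + degSet G S T ∎
    where open ≤-Reasoning

-- Opened only now: in scope, the prefix +_ makes sections such as (n +_) ambiguous.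
open ℤ using (+_)

+≤-+ : ∀ {c x y z} → c + y ≤ x + z → + c ℤ.≤ (+ x ℤ.- + y) ℤ.+ + z
+≤-+ {c} {x} {y} {z} c+y≤x+z = begin
  + c                          ≡⟨ cancel (+ c) (+ y) ⟩
  (+ c ℤ.+ + y) ℤ.- + y        ≡⟨ cong (ℤ._- + y) (ℤP.pos-+ c y) ⟨
  + (c + y) ℤ.- + y            ≤⟨ ℤP.+-monoˡ-≤ (ℤ.- + y) (ℤ.+≤+ c+y≤x+z) ⟩
  + (x + z) ℤ.- + y            ≡⟨ cong (ℤ._- + y) (ℤP.pos-+ x z) ⟩
  (+ x ℤ.+ + z) ℤ.- + y        ≡⟨ swap (+ x) (+ y) (+ z) ⟩
  (+ x ℤ.- + y) ℤ.+ + z        ∎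
  where
  open ℤP.≤-Reasoning
  cancel : ∀ u v → u ≡ (u ℤ.+ v) ℤ.- v
  cancel = ℤ-solve-∀
  swap : ∀ u v w → (u ℤ.+ w) ℤ.- v ≡ (u ℤ.- v) ℤ.+ w
  swap = ℤ-solve-∀

lemma3 : (a b n k m : ℕ) → 1 ≤ a → a < b → 1 ≤ n → 2 ≤ k → k ≤ b →
    (G : Graph m) →
    MinDegAtLeast G (a + n) →
    IsoToughnessAtLeast G ((a ∸ 1) * b + (a + k * n ∸ 1)) b →
    (S : Subset m) → Nonempty (Tset G S a) →
    + (k * n) ℤ.≤ deltaG G a b S
lemma3 a b n k m 1≤a a<b 1≤n 2≤k k≤b G δ≥a+n tough S T≢∅ =
  +≤-+ (kn+a∣T∣≤b∣S∣+degSet 1≤a a<b 1≤n 2≤k k≤b G δ≥a+n tough S T≢∅)
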